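{- Let $G=([n],E)$ be a directed acyclic graph with weights $w\in\mathbb{R}^E$. The weighted transitive reduction $G^\flat_w$ always exists and is unique, and it is given by $$G^\flat_w=\bigcup_{s\in[n]}\bigcap\{\,T^{(s)} : T^{(s)}\text{ is a shortest-path tree at }s\text{ for }w\,\}.$$
   Context: The weighted transitive reduction $G^\flat_w$ is the subgraph of $G$ containing an edge $j\to i$ (with weight $w(j\to i)$) exactly when the one-edge path $j\to i$ is the unique shortest (minimum total weight) directed path from $j$ to $i$ in $G$. For $s\in[n]$, a shortest-path tree at $s$ is a spanning tree $T^{(s)}$ (with edges of $G$) of the set of nodes reachable from $s$ (including $s$), in which $s$ has no incoming edges, such that for every edge $j\to i$ of $G$ (among reachable nodes) one has $w(j\to i)+p_j\not< p_i$, where $p_k$ is the length of the path $s\rightsquigarrow k$ in $T^{(s)}$. Graphs are compared and combined by union/intersection of edge sets. -}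

module Defs where

open import Level using (Level; suc; _⊔_) renaming (zero to lzero)
open import Data.Nat using (ℕ)
open import Data.Fin using (Fin)
open import Data.Bool using (Bool; T)
open import Data.Product using (Σ; ∃; _×_; _,_)
open import Data.Empty using (⊥)
open import Relation.Nullary using (¬_)
open import Relation.Binary.PropositionalEquality using (_≡_; _≢_)
open import Algebra.Structures using (IsAbelianGroup)
open import Relation.Binary.Structures using (IsTotalOrder)

-- Weights: the paper uses w ∈ ℝ^E.  The standard library has no reals,
-- so weights live in an arbitrary totally ordered abelian group
-- (ℝ with + and ≤ is one).

record OrderedAbelianGroup (c ℓ : Level) : Set (suc (c ⊔ ℓ)) where
  infixl 6 _+_
  infix 4 _≤_ _<_
  field
    Carrier        : Set c
    _+_            : Carrier → Carrier → Carrier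
    0#             : Carrier
    -_             : Carrier → Carrier
    _≤_            : Carrier → Carrier → Set ℓ
    isAbelianGroup : IsAbelianGroup _≡_ _+_ 0# -_
    isTotalOrder   : IsTotalOrder _≡_ _≤_
    +-mono-≤       : ∀ {x y} z → x ≤ y → x + z ≤ y + z

  _<_ : Carrier → Carrier → Set (c ⊔ ℓ)
  x < y = x ≤ y × x ≢ y

Graph : ℕ → Set
Graph n = Fin n → Fin n → Bool

module _ {n : ℕ} where

  Edge : Graph n → Fin n → Fin n → Set
  Edge E j i = T (E j i)

  data Path (E : Graph n) : Fin n → Fin n → Set where
    here : ∀ {x} → Path E x x
    step : ∀ {x y z} → Edge E x y → Path E y z → Path E x z

  Reachable : Graph n → Fin n → Fin n → Set
  Reachable E s x = Path E s x

  Acyclic : Graph n → Set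
  Acyclic E = ∀ {x y} → Edge E x y → Path E y x → ⊥

  _⊆_ : Graph n → Graph n → Set
  H ⊆ E = ∀ {j i} → Edge H j i → Edge E j i

module _ {c ℓ : Level} (W : OrderedAbelianGroup c ℓ) {n : ℕ} where
  open OrderedAbelianGroup W

  Weights : Set c
  Weights = Fin n → Fin n → Carrier

  weight : {H : Graph n} → Weights → ∀ {x y} → Path H x y → Carrier
  weight w here = 0#
  weight w (step {x} {y} e p) = w x y + weight w p

  -- Edge j → i belongs to the weighted transitive reduction G♭_w:
  -- the one-edge path j → i is the unique shortest path from j to i in G.
  InReduction : (E : Graph n) → Weights → Fin n → Fin n → Set ℓ
  InReduction E w j i =
    Σ (Edge E j i) λ e →
      (∀ (p : Path E j i) → weight {E} w (step e here) ≤ weight w p)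
      × (∀ (p : Path E j i) → weight w p ≤ weight {E} w (step e here) → p ≡ step e here)

  record SpanningTreeAt (E : Graph n) (s : Fin n) (T′ : Graph n) : Set where
    field
      sub          : T′ ⊆ E
      inReachable  : ∀ {j i} → Edge T′ j i → Reachable E s j × Reachable E s i
      rootNoIn     : ∀ {j} → ¬ Edge T′ j s
      uniqueParent : ∀ {j j′ i} → Edge T′ j i → Edge T′ j′ i → j ≡ j′
      spanning     : ∀ {i} → Reachable E s i → Reachable T′ s i

  record ShortestPathTreeAt (E : Graph n) (w : Weights) (s : Fin n) (T′ : Graph n)
         : Set (c ⊔ ℓ) where
    field
      isSpanningTree : SpanningTreeAt E s T′
      optimal : ∀ {j i} → Edge E j i → Reachable E s j → Reachable E s i →
                (pj : Path T′ s j) (pi : Path T′ s i) →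
                ¬ (w j i + weight w pj < weight w pi)

  InUnionOfIntersections : (E : Graph n) → Weights → Fin n → Fin n → Set (c ⊔ ℓ)
  InUnionOfIntersections E w j i =
    ∃ λ (s : Fin n) → ∀ (T′ : Graph n) → ShortestPathTreeAt E w s T′ → Edge T′ j i

{-# OPTIONS --safe #-}
module Submission where

open import Defs
open import Level using (Level)
open import Data.Nat using (ℕ)
open import Data.Fin using (Fin)
open import Function.Bundles using (_⇔_)

-- If j → i is the unique shortest path from j to i, then the tree path j ⇝ i of
-- any shortest-path tree at j is no heavier than the edge, hence is the edge.
-- Conversely, choosing for every node x reachable from s one tight edge k → x
-- (dist k + w(k→x) = dist x) yields a shortest-path tree at s, so an edge j → i
-- lying in all of them is the only tight edge into i.  A path j ⇝ i ending with
-- k → i and no heavier than j → i would make k → i tight, forcing k = j and, by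
-- acyclicity, the path to be the edge itself.  Acyclicity also bounds the length
-- of paths by n, which is what makes shortest distances exist.

open import Function using (const)
open import Function.Bundles using (mk⇔)
import Data.Nat as ℕ
import Data.Nat.Properties as ℕₚ
open import Data.Fin using (zero; suc; _≟_)
open import Data.Fin.Properties using (pigeonhole)
open import Data.Vec.Functional using (updateAt)
open import Data.Vec.Functional.Properties using (updateAt-updates; updateAt-minimal)
open import Data.Bool.Properties using (T?; T-irrelevant)
open import Data.Product using (Σ; ∃; _×_; _,_; proj₁; proj₂)
open import Data.Sum using (_⊎_; inj₁; inj₂)
open import Data.Unit using (⊤)
open import Data.Empty using (⊥; ⊥-elim)
open import Relation.Nullary using (¬_; Dec; yes; no)
open import Relation.Nullary.Decidable
  using (⌊_⌋; toWitness; fromWitness; _×-dec_; ¬?; decidable-stable)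
open import Relation.Binary.Bundles using (Poset)
open import Relation.Binary.PropositionalEquality
  using (_≡_; _≢_; refl; sym; trans; cong; subst; subst₂)
open import Algebra.Structures using (IsAbelianGroup)
open import Relation.Binary.Structures using (IsTotalOrder)
import Relation.Binary.Reasoning.PartialOrder as PosetReasoning

module _ {n : ℕ} {G : Graph n} where

  infixr 5 _++_
  _++_ : ∀ {a b c} → Path G a b → Path G b c → Path G a c
  here     ++ q = q
  step e p ++ q = step e (p ++ q)

  length : ∀ {a b} → Path G a b → ℕ
  length here       = 0
  length (step _ p) = ℕ.suc (length p)

  length-∷ʳ : ∀ {a b c} (p : Path G a b) (e : Edge G b c) →
              length (p ++ step e here) ≡ ℕ.suc (length p)
  length-∷ʳ here       e = refl
  length-∷ʳ (step _ p) e = cong ℕ.suc (length-∷ʳ p e)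

  data SnocView {a} : ∀ {b} → Path G a b → Set where
    []   : SnocView here
    _∷ʳ_ : ∀ {k b} (q : Path G a k) (e : Edge G k b) → SnocView (q ++ step e here)

  snocView : ∀ {a b} (p : Path G a b) → SnocView p
  snocView here = []
  snocView (step e p) with snocView p
  ... | []     = here ∷ʳ e
  ... | q ∷ʳ f = step e q ∷ʳ f

  vertex : ∀ {a b} (p : Path G a b) → Fin (ℕ.suc (length p)) → Fin n
  vertex {a} p          zero    = a
  vertex     (step _ p) (suc t) = vertex p t

  prefix : ∀ {a b} (p : Path G a b) (t : Fin (ℕ.suc (length p))) → Path G a (vertex p t)
  prefix p          zero    = here
  prefix (step e p) (suc t) = step e (prefix p t)

  Acyclic⇒vertex-injective : Acyclic G → ∀ {a b} (p : Path G a b) {t u} →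
                             t Data.Fin.< u → vertex p t ≢ vertex p u
  Acyclic⇒vertex-injective acyclic (step e p) {zero} {suc u} _ a≡v =
    acyclic e (subst (Path G _) (sym a≡v) (prefix p u))
  Acyclic⇒vertex-injective acyclic (step e p) {suc t} {suc u} (ℕ.s≤s t<u) =
    Acyclic⇒vertex-injective acyclic p t<u

  Acyclic⇒length<n : Acyclic G → ∀ {a b} (p : Path G a b) → length p ℕ.< n
  Acyclic⇒length<n acyclic p = ℕₚ.≮⇒≥ λ n<length+1 →
    let (t , u , t<u , v≡v) = pigeonhole n<length+1 (vertex p)
    in Acyclic⇒vertex-injective acyclic p t<u v≡v

  Acyclic⇒loop≡here : Acyclic G → ∀ {a} (p : Path G a a) → p ≡ here
  Acyclic⇒loop≡here acyclic here       = refl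
  Acyclic⇒loop≡here acyclic (step e p) = ⊥-elim (acyclic e p)

module _ {n : ℕ} {G H : Graph n} (f : G ⊆ H) where

  map : ∀ {a b} → Path G a b → Path H a b
  map here       = here
  map (step e p) = step (f e) (map p)

  map≡step⇒edge : ∀ {a b} (p : Path G a b) {e : Edge H a b} → map p ≡ step e here → Edge G a b
  map≡step⇒edge (step e here) refl = e

module _ {c ℓ : Level} (W : OrderedAbelianGroup c ℓ) where
  open OrderedAbelianGroup W
  private
    module TO = IsTotalOrder isTotalOrder
    module AG = IsAbelianGroup isAbelianGroup

  poset : Poset c c ℓ
  poset = record { isPartialOrder = TO.isPartialOrder }

  open PosetReasoning poset

  +-monoʳ-≤ : ∀ {x y} z → x ≤ y → z + x ≤ z + y
  +-monoʳ-≤ {x} {y} z x≤y = subst₂ _≤_ (AG.comm x z) (AG.comm y z) (+-mono-≤ z x≤y)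

  ≤⇒≯ : ∀ {x y} → x ≤ y → ¬ (y < x)
  ≤⇒≯ x≤y (y≤x , y≢x) = y≢x (TO.antisym y≤x x≤y)

  module _ {n : ℕ} (w : Weights W {n}) where

    wt : ∀ {G : Graph n} {a b} → Path G a b → Carrier
    wt = weight W w

    wt-++ : ∀ {G : Graph n} {a b c} (p : Path G a b) (q : Path G b c) →
            wt (p ++ q) ≡ wt p + wt q
    wt-++ here q = sym (AG.identityˡ (wt q))
    wt-++ (step {x} {y} e p) q = begin-equality
      w x y + wt (p ++ q)     ≡⟨ cong (w x y +_) (wt-++ p q) ⟩
      w x y + (wt p + wt q)   ≡⟨ sym (AG.assoc (w x y) (wt p) (wt q)) ⟩
      w x y + wt p + wt q     ∎

    wt-edge : ∀ {G : Graph n} {a b} (e : Edge G a b) → wt {G} (step e here) ≡ w a b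
    wt-edge {a = a} {b} e = AG.identityʳ (w a b)

    wt-∷ʳ : ∀ {G : Graph n} {a b c} (p : Path G a b) (e : Edge G b c) →
            wt (p ++ step e here) ≡ wt p + w b c
    wt-∷ʳ {G} p e = trans (wt-++ p (step e here)) (cong (wt p +_) (wt-edge {G} e))

    wt-map : ∀ {G H : Graph n} (f : G ⊆ H) {a b} (p : Path G a b) → wt (map f p) ≡ wt p
    wt-map f here               = refl
    wt-map f (step {x} {y} e p) = cong (w x y +_) (wt-map f p)

    module _ (E : Graph n) where

      reduction⇒in-every-SPT : ∀ {j i} → InReduction W E w j i →
                               ∀ T → ShortestPathTreeAt W E w j T → Edge T j i
      reduction⇒in-every-SPT {j} {i} (e , minimal , unique) T spt =
        decidable-stable (T? (T j i)) λ ¬edge →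
          optimal e here (step e here) here pᵢ (edge≤pᵢ , λ edge≡pᵢ → ¬edge (pᵢ-is-edge edge≡pᵢ))
        where
        open ShortestPathTreeAt spt
        open SpanningTreeAt isSpanningTree

        pᵢ : Path T j i
        pᵢ = spanning (step e here)

        edge≤pᵢ : wt {E} (step e here) ≤ wt pᵢ
        edge≤pᵢ = subst (wt {E} (step e here) ≤_) (wt-map sub pᵢ) (minimal (map sub pᵢ))

        pᵢ-is-edge : wt {E} (step e here) ≡ wt pᵢ → Edge T j i
        pᵢ-is-edge edge≡pᵢ = map≡step⇒edge sub pᵢ (unique (map sub pᵢ)
          (TO.reflexive (trans (wt-map sub pᵢ) (sym edge≡pᵢ))))

      -- Either no path satisfies P, or some path, which need not satisfy P itself,
      -- is no heavier than every path satisfying P.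
      Minimum : ∀ a b → (Path E a b → Set) → Set ℓ
      Minimum a b P = (∀ p → ¬ P p) ⊎ Σ (Path E a b) λ q → ∀ p → P p → wt q ≤ wt p

      module _ {a b : Fin n} where

        minimum-⊆ : {P Q : Path E a b → Set} → (∀ p → Q p → P p) →
                    Minimum a b P → Minimum a b Q
        minimum-⊆ Q⊆P (inj₁ none)     = inj₁ λ p Qp → none p (Q⊆P p Qp)
        minimum-⊆ Q⊆P (inj₂ (q , q≤)) = inj₂ (q , λ p Qp → q≤ p (Q⊆P p Qp))

        minimum-⊎ : {P Q : Path E a b → Set} → Minimum a b P → Minimum a b Q →
                    Minimum a b (λ p → P p ⊎ Q p)
        minimum-⊎ (inj₁ noP) (inj₁ noQ) = inj₁ λ where
          p (inj₁ Pp) → noP p Pp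
          p (inj₂ Qp) → noQ p Qp
        minimum-⊎ (inj₁ noP) (inj₂ (q , q≤)) = inj₂ (q , λ where
          p (inj₁ Pp) → ⊥-elim (noP p Pp)
          p (inj₂ Qp) → q≤ p Qp)
        minimum-⊎ (inj₂ (q , q≤)) (inj₁ noQ) = inj₂ (q , λ where
          p (inj₁ Pp) → q≤ p Pp
          p (inj₂ Qp) → ⊥-elim (noQ p Qp))
        minimum-⊎ (inj₂ (q , q≤)) (inj₂ (q′ , q′≤)) with TO.total (wt q) (wt q′)
        ... | inj₁ q≤q′ = inj₂ (q , λ where
          p (inj₁ Pp) → q≤ p Pp
          p (inj₂ Qp) → TO.trans q≤q′ (q′≤ p Qp))
        ... | inj₂ q′≤q = inj₂ (q′ , λ where
          p (inj₁ Pp) → TO.trans q′≤q (q≤ p Pp)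
          p (inj₂ Qp) → q′≤ p Qp)

        minimum-∃ : ∀ m (P : Fin m → Path E a b → Set) → (∀ y → Minimum a b (P y)) →
                    Minimum a b (λ p → ∃ λ y → P y p)
        minimum-∃ ℕ.zero    P _       = inj₁ λ _ ()
        minimum-∃ (ℕ.suc m) P minimumₚ = minimum-⊆ split
          (minimum-⊎ (minimumₚ zero) (minimum-∃ m (λ y → P (suc y)) (λ y → minimumₚ (suc y))))
          where
          split : ∀ p → ∃ (λ y → P y p) → P zero p ⊎ ∃ λ y → P (suc y) p
          split p (zero  , Pp) = inj₁ Pp
          split p (suc y , Pp) = inj₂ (y , Pp)

      FirstHop : ∀ {a b} → Fin n → ℕ → Path E a b → Set
      FirstHop y k here                  = ⊥
      FirstHop y k (step {y = y′} _ p) = y′ ≡ y × length p ℕ.≤ k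

      minimum-length≤ : ∀ k a b → Minimum a b (λ p → length p ℕ.≤ k)
      minimum-firstHop : ∀ k a b y → Minimum a b (FirstHop y k)

      minimum-length≤ ℕ.zero a b with a ≟ b
      ... | yes refl = inj₂ (here , λ { here _ → TO.refl ; (step _ _) () })
      ... | no a≢b   = inj₁ λ { here _ → a≢b refl ; (step _ _) () }
      minimum-length≤ (ℕ.suc k) a b = minimum-⊆ split
        (minimum-⊎ (minimum-length≤ ℕ.zero a b) (minimum-∃ n (λ y → FirstHop y k) (minimum-firstHop k a b)))
        where
        split : ∀ p → length p ℕ.≤ ℕ.suc k → length p ℕ.≤ 0 ⊎ ∃ λ y → FirstHop y k p
        split here                _            = inj₁ ℕ.z≤n
        split (step {y = y} _ p) (ℕ.s≤s p≤k) = inj₂ (y , refl , p≤k)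

      minimum-firstHop k a b y with T? (E a y)
      ... | no ¬e = inj₁ λ { here () ; (step e _) (refl , _) → ¬e e }
      ... | yes e with minimum-length≤ k y b
      ...   | inj₁ none      = inj₁ λ { here () ; (step _ p) (refl , p≤k) → none p p≤k }
      ...   | inj₂ (q , q≤) = inj₂ (step e q , λ
                { here () ; (step _ p) (refl , p≤k) → +-monoʳ-≤ (w a y) (q≤ p p≤k) })

      module _ (acyclic : Acyclic E) where

        minimum : ∀ a b → Minimum a b (λ _ → ⊤)
        minimum a b = minimum-⊆ (λ p _ → ℕₚ.<⇒≤ (Acyclic⇒length<n acyclic p)) (minimum-length≤ n a b)

        module _ (s : Fin n) where

          -- 0# on nodes that are not reachable from s.
          dist : Fin n → Carrier
          dist x with minimum s x
          ... | inj₁ _       = 0#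
          ... | inj₂ (q , _) = wt q

          reachable? : ∀ x → Dec (Reachable E s x)
          reachable? x with minimum s x
          ... | inj₁ none    = no λ p → none p _
          ... | inj₂ (q , _) = yes q

          dist≤wt : ∀ {x} (p : Path E s x) → dist x ≤ wt p
          dist≤wt {x} p with minimum s x
          ... | inj₁ none    = ⊥-elim (none p _)
          ... | inj₂ (q , q≤) = q≤ p _

          dist-attained : ∀ {x} → Reachable E s x → Σ (Path E s x) λ q → wt q ≡ dist x
          dist-attained {x} p with minimum s x
          ... | inj₁ none    = ⊥-elim (none p _)
          ... | inj₂ (q , _) = q , refl

          dist-source : dist s ≡ 0#
          dist-source with dist-attained here
          ... | q , wt-q = trans (sym wt-q) (cong wt (Acyclic⇒loop≡here acyclic q))

          dist-triangle : ∀ {j k} → Reachable E s j → (q : Path E j k) → dist k ≤ dist j + wt q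
          dist-triangle {j} {k} rⱼ q with dist-attained rⱼ
          ... | pⱼ , wt-pⱼ = begin
            dist k         ≤⟨ dist≤wt (pⱼ ++ q) ⟩
            wt (pⱼ ++ q)   ≡⟨ wt-++ pⱼ q ⟩
            wt pⱼ + wt q   ≡⟨ cong (_+ wt q) wt-pⱼ ⟩
            dist j + wt q  ∎

          dist-relax : ∀ {k x} → Edge E k x → Reachable E s k → dist x ≤ dist k + w k x
          dist-relax {k} {x} e rₖ =
            subst (dist x ≤_) (cong (dist k +_) (wt-edge {E} e)) (dist-triangle rₖ (step e here))

          record TightEdge (k x : Fin n) : Set c where
            field
              edge      : Edge E k x
              reachable : Reachable E s k
              tight     : dist k + w k x ≡ dist x

          open TightEdge

          tightEdge : ∀ {k x} (e : Edge E k x) (rₖ : Reachable E s k) →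
                      dist k + w k x ≤ dist x → TightEdge k x
          tightEdge e rₖ ≤dist = record
            { edge = e ; reachable = rₖ ; tight = TO.antisym ≤dist (dist-relax e rₖ) }

          tightEdgeInto : ∀ {x} → Reachable E s x → x ≢ s → ∃ λ k → TightEdge k x
          tightEdgeInto rₓ x≢s with dist-attained rₓ
          ... | q , wt-q with snocView q
          ...   | []                 = ⊥-elim (x≢s refl)
          ...   | _∷ʳ_ {k} {x} qₖ e = k , tightEdge e qₖ (begin
                  dist k + w k x              ≤⟨ +-mono-≤ (w k x) (dist≤wt qₖ) ⟩
                  wt qₖ + w k x               ≡⟨ sym (wt-∷ʳ qₖ e) ⟩
                  wt (qₖ ++ step e here)      ≡⟨ wt-q ⟩
                  dist x                      ∎)

          tightEdge-via : ∀ {j k i} → TightEdge j i → (q : Path E j k) (e : Edge E k i) →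
                          wt (q ++ step e here) ≤ w j i → TightEdge k i
          tightEdge-via {j} {k} {i} tⱼ q e q-e≤ = tightEdge e (reachable tⱼ ++ q) (begin
            dist k + w k i                 ≤⟨ +-mono-≤ (w k i) (dist-triangle (reachable tⱼ) q) ⟩
            dist j + wt q + w k i          ≡⟨ AG.assoc (dist j) (wt q) (w k i) ⟩
            dist j + (wt q + w k i)        ≡⟨ cong (dist j +_) (sym (wt-∷ʳ q e)) ⟩
            dist j + wt (q ++ step e here) ≤⟨ +-monoʳ-≤ (dist j) q-e≤ ⟩
            dist j + w j i                 ≡⟨ tight tⱼ ⟩
            dist i                         ∎)

          only-tightEdge⇒unique-shortest :
            ∀ {j i} (tⱼ : TightEdge j i) → (∀ {k} → TightEdge k i → k ≡ j) →
            ∀ (p : Path E j i) → wt p ≤ w j i → p ≡ step (edge tⱼ) here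
          only-tightEdge⇒unique-shortest tⱼ only p p≤ with snocView p
          ... | []      = ⊥-elim (acyclic (edge tⱼ) here)
          ... | q ∷ʳ e with only (tightEdge-via tⱼ q e p≤)
          ...   | refl rewrite Acyclic⇒loop≡here acyclic q =
                  cong (λ e → step e here) (T-irrelevant e (edge tⱼ))

          TightParent : (Fin n → Fin n) → Set c
          TightParent parent = ∀ {x} → Reachable E s x → x ≢ s → TightEdge (parent x) x

          parent₀ : Fin n → Fin n
          parent₀ x with reachable? x | x ≟ s
          ... | yes rₓ | no x≢s = proj₁ (tightEdgeInto rₓ x≢s)
          ... | _      | _      = x

          parent₀-tight : TightParent parent₀
          parent₀-tight {x} rₓ x≢s with reachable? x | x ≟ s
          ... | yes rₓ′ | no x≢s′ = proj₂ (tightEdgeInto rₓ′ x≢s′)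
          ... | no ¬rₓ  | _       = ⊥-elim (¬rₓ rₓ)
          ... | yes _   | yes x≡s = ⊥-elim (x≢s x≡s)

          redirect-tight : ∀ {parent k i} → TightParent parent → TightEdge k i →
                           TightParent (updateAt parent i (const k))
          redirect-tight {parent} {k} {i} tight-parent tₖ {x} rₓ x≢s with x ≟ i
          ... | yes refl = subst (λ y → TightEdge y x) (sym (updateAt-updates i parent)) tₖ
          ... | no x≢i   = subst (λ y → TightEdge y x) (sym (updateAt-minimal x i parent x≢i))
                                 (tight-parent rₓ x≢s)

          TreeEdge : (Fin n → Fin n) → Fin n → Fin n → Set
          TreeEdge parent y x = Reachable E s x × x ≢ s × parent x ≡ y

          treeOf : (Fin n → Fin n) → Graph n
          treeOf parent y x = ⌊ reachable? x ×-dec ¬? (x ≟ s) ×-dec (parent x ≟ y) ⌋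

          module _ (parent : Fin n → Fin n) where

            treeEdge⁻ : ∀ {y x} → Edge (treeOf parent) y x → TreeEdge parent y x
            treeEdge⁻ = toWitness

            treeEdge⁺ : ∀ {y x} → TreeEdge parent y x → Edge (treeOf parent) y x
            treeEdge⁺ = fromWitness

            treeEdge-parent : ∀ {y x} → Edge (treeOf parent) y x → parent x ≡ y
            treeEdge-parent t = proj₂ (proj₂ (treeEdge⁻ t))

          module _ (parent : Fin n → Fin n) (tight-parent : TightParent parent) where

            treeEdge-tight : ∀ {y x} → Edge (treeOf parent) y x → TightEdge y x
            treeEdge-tight t with treeEdge⁻ parent t
            ... | rₓ , x≢s , refl = tight-parent rₓ x≢s

            tree-path : ∀ k {x} → (∀ (p : Path E s x) → length p ℕ.< k) →
                        Reachable E s x → Path (treeOf parent) s x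
            tree-path ℕ.zero    bound rₓ = ⊥-elim (ℕₚ.n≮0 (bound rₓ))
            tree-path (ℕ.suc k) {x} bound rₓ with x ≟ s
            ... | yes refl = here
            ... | no x≢s   =
              tree-path k bound′ (reachable tₓ) ++ step (treeEdge⁺ parent (rₓ , x≢s , refl)) here
              where
              tₓ : TightEdge (parent x) x
              tₓ = tight-parent rₓ x≢s

              bound′ : ∀ (p : Path E s (parent x)) → length p ℕ.< k
              bound′ p = ℕ.s<s⁻¹ (subst (ℕ._< ℕ.suc k) (length-∷ʳ p (edge tₓ))
                                         (bound (p ++ step (edge tₓ) here)))

            tree-wt : ∀ {a x} (p : Path (treeOf parent) a x) → dist a + wt p ≡ dist x
            tree-wt {a} here = AG.identityʳ (dist a)
            tree-wt {a} {x} (step {y = y} t p) = begin-equality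
              dist a + (w a y + wt p)  ≡⟨ sym (AG.assoc (dist a) (w a y) (wt p)) ⟩
              dist a + w a y + wt p    ≡⟨ cong (_+ wt p) (tight (treeEdge-tight t)) ⟩
              dist y + wt p            ≡⟨ tree-wt p ⟩
              dist x                   ∎

            tree-wt-from-source : ∀ {x} (p : Path (treeOf parent) s x) → wt p ≡ dist x
            tree-wt-from-source {x} p = begin-equality
              wt p           ≡⟨ sym (AG.identityˡ (wt p)) ⟩
              0# + wt p      ≡⟨ cong (_+ wt p) (sym dist-source) ⟩
              dist s + wt p  ≡⟨ tree-wt p ⟩
              dist x         ∎

            tree-optimal : ∀ {j i} → Edge E j i → Reachable E s j →
                           (pⱼ : Path (treeOf parent) s j) (pᵢ : Path (treeOf parent) s i) →
                           wt pᵢ ≤ w j i + wt pⱼ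
            tree-optimal {j} {i} e rⱼ pⱼ pᵢ = begin
              wt pᵢ           ≡⟨ tree-wt-from-source pᵢ ⟩
              dist i          ≤⟨ dist-relax e rⱼ ⟩
              dist j + w j i  ≡⟨ AG.comm (dist j) (w j i) ⟩
              w j i + dist j  ≡⟨ cong (w j i +_) (sym (tree-wt-from-source pⱼ)) ⟩
              w j i + wt pⱼ   ∎

            treeOf-isSPT : ShortestPathTreeAt W E w s (treeOf parent)
            treeOf-isSPT = record
              { isSpanningTree = record
                { sub          = λ t → edge (treeEdge-tight t)
                ; inReachable  = λ t → reachable (treeEdge-tight t) , proj₁ (treeEdge⁻ parent t)
                ; rootNoIn     = λ t → proj₁ (proj₂ (treeEdge⁻ parent t)) refl
                ; uniqueParent = λ t t′ → trans (sym (treeEdge-parent parent t)) (treeEdge-parent parent t′)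
                ; spanning     = tree-path n (Acyclic⇒length<n acyclic)
                }
              ; optimal = λ e rⱼ _ pⱼ pᵢ → ≤⇒≯ (tree-optimal e rⱼ pⱼ pᵢ)
              }

          in-every-SPT⇒reduction : ∀ {j i} → (∀ T → ShortestPathTreeAt W E w s T → Edge T j i) →
                                   InReduction W E w j i
          in-every-SPT⇒reduction {j} {i} in-every-SPT = edge tⱼ , minimal , unique
            where
            tⱼ : TightEdge j i
            tⱼ = treeEdge-tight parent₀ parent₀-tight
                   (in-every-SPT _ (treeOf-isSPT parent₀ parent₀-tight))

            only-tⱼ : ∀ {k} → TightEdge k i → k ≡ j
            only-tⱼ {k} tₖ = trans (sym (updateAt-updates i parent₀))
              (treeEdge-parent parent₁
                (in-every-SPT _ (treeOf-isSPT parent₁ (redirect-tight parent₀-tight tₖ))))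
              where
              parent₁ : Fin n → Fin n
              parent₁ = updateAt parent₀ i (const k)

            edgePath : Path E j i
            edgePath = step (edge tⱼ) here

            unique : ∀ p → wt p ≤ wt edgePath → p ≡ edgePath
            unique p p≤ = only-tightEdge⇒unique-shortest tⱼ only-tⱼ p
              (subst (wt p ≤_) (wt-edge {E} (edge tⱼ)) p≤)

            minimal : ∀ p → wt edgePath ≤ wt p
            minimal p with TO.total (wt edgePath) (wt p)
            ... | inj₁ edge≤p = edge≤p
            ... | inj₂ p≤edge = subst (λ q → wt edgePath ≤ wt q) (sym (unique p p≤edge)) TO.refl

proposition4p6 : ∀ {c ℓ} (W : OrderedAbelianGroup c ℓ) (n : ℕ) (E : Graph n) (w : Weights W {n}) →
    Acyclic E →
    ∀ (j i : Fin n) → InReduction W E w j i ⇔ InUnionOfIntersections W E w j i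
proposition4p6 W n E w acyclic j i = mk⇔
  (λ reduced → j , reduction⇒in-every-SPT W w E reduced)
  (λ (s , in-every-SPT) → in-every-SPT⇒reduction W w E acyclic s in-every-SPT)
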